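{- Let $G$ be a connected graph having a minimum connected dominating set $D$ such that either $\mathrm{diam}(G[D])\leq 2$, or $D$ is a perfect connected dominating set with $\mathrm{diam}(G[D])=3$. Then $\gamma_c(G)=\gamma_{\rm wcon}(G)$.
   Context: Graphs are finite, simple, undirected, connected. A set $D\subseteq V(G)$ is dominating if every vertex of $V(G)-D$ has a neighbour in $D$; it is a connected dominating set if moreover $G[D]$ is connected. $\gamma_c(G)$ is the minimum size of a connected dominating set; a minimum connected dominating set is one of size $\gamma_c(G)$. A connected dominating set $D$ is perfect if every vertex of $V(G)-D$ has exactly one neighbour in $D$. A set $X$ is weakly convex if for any $a,b\in X$ some shortest $(a-b)$-path in $G$ has all its vertices in $X$; $\gamma_{\rm wcon}(G)$ is the minimum size of a weakly convex dominating set. $\mathrm{diam}(H)$ is the maximum distance between two vertices of $H$. -}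

module Defs where

open import Data.Nat using (ℕ; zero; suc; _≤_)
open import Data.Fin using (Fin)
open import Data.Fin.Subset using (Subset; _∈_; _∉_; ∣_∣)
open import Data.Product using (Σ; ∃; ∃-syntax; _×_; _,_)
open import Relation.Nullary using (¬_; Dec)
open import Relation.Binary.PropositionalEquality using (_≡_)
open import Level using (0ℓ)

record Graph (n : ℕ) : Set₁ where
  field
    Adj     : Fin n → Fin n → Set
    adj?    : ∀ u v → Dec (Adj u v)
    sym     : ∀ {u v} → Adj u v → Adj v u
    irrefl  : ∀ {u} → ¬ Adj u u

open Graph public

module _ {n : ℕ} (G : Graph n) where

  data WalkIn (P : Fin n → Set) : Fin n → Fin n → ℕ → Set where
    here : ∀ {a} → P a → WalkIn P a a zero
    step : ∀ {a b c k} → Adj G a b → P a → WalkIn P b c k → WalkIn P a c (suc k)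

  Walk : Fin n → Fin n → ℕ → Set
  Walk = WalkIn (λ _ → Fin n)

  Connected : Set
  Connected = ∀ a b → ∃[ k ] Walk a b k

  Dist : Fin n → Fin n → ℕ → Set
  Dist a b k = Walk a b k × (∀ m → Walk a b m → k ≤ m)

  WalkInSet : Subset n → Fin n → Fin n → ℕ → Set
  WalkInSet X = WalkIn (λ v → v ∈ X)

  DistIn : Subset n → Fin n → Fin n → ℕ → Set
  DistIn X a b k = WalkInSet X a b k × (∀ m → WalkInSet X a b m → k ≤ m)

  Dominating : Subset n → Set
  Dominating D = ∀ v → v ∉ D → ∃[ u ] (u ∈ D × Adj G v u)

  InducedConnected : Subset n → Set
  InducedConnected X = (∃[ v ] v ∈ X) × (∀ a b → a ∈ X → b ∈ X → ∃[ k ] WalkInSet X a b k)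

  ConnectedDominating : Subset n → Set
  ConnectedDominating D = Dominating D × InducedConnected D

  MinConnectedDominating : Subset n → Set
  MinConnectedDominating D =
    ConnectedDominating D × (∀ D' → ConnectedDominating D' → ∣ D ∣ ≤ ∣ D' ∣)

  PerfectCDS : Subset n → Set
  PerfectCDS D = ConnectedDominating D ×
    (∀ v u u' → v ∉ D → u ∈ D → u' ∈ D → Adj G v u → Adj G v u' → u ≡ u')

  DiamInducedLe2 : Subset n → Set
  DiamInducedLe2 X = ∀ a b → a ∈ X → b ∈ X → ∃[ k ] (k ≤ 2 × DistIn X a b k)

  DiamInducedEq3 : Subset n → Set
  DiamInducedEq3 X =
    (∀ a b → a ∈ X → b ∈ X → ∃[ k ] (k ≤ 3 × DistIn X a b k)) ×
    (∃[ a ] ∃[ b ] (a ∈ X × b ∈ X × DistIn X a b 3))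

  WeaklyConvex : Subset n → Set
  WeaklyConvex X = ∀ a b → a ∈ X → b ∈ X → ∃[ k ] (Dist a b k × WalkInSet X a b k)

  WeaklyConvexDominating : Subset n → Set
  WeaklyConvexDominating X = WeaklyConvex X × Dominating X

  IsGammaC : ℕ → Set
  IsGammaC k = (∃[ D ] (ConnectedDominating D × ∣ D ∣ ≡ k)) ×
               (∀ D → ConnectedDominating D → k ≤ ∣ D ∣)

  IsGammaWcon : ℕ → Set
  IsGammaWcon k = (∃[ D ] (WeaklyConvexDominating D × ∣ D ∣ ≡ k)) ×
                  (∀ D → WeaklyConvexDominating D → k ≤ ∣ D ∣)

-- A shortest path of G[D] between a, b ∈ D is also shortest in G as soon as
-- every G-walk shorter than diam(G[D]) between vertices of D can be replaced
-- by a walk inside D that is no longer. Walks of length 0 or 1 lie in D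
-- already; for a walk a – x – b with x ∉ D, perfectness of D forces a = b.
-- Hence in both cases D is a weakly convex dominating set, and since every
-- weakly convex dominating set is a connected dominating set,
-- γ_wcon(G) = |D| = γ_c(G).
module Submission where

open import Defs
open import Data.Nat using (ℕ; suc; _≤_; _<_; z≤n; s≤s)
open import Data.Nat.Properties using (≤-trans; ≤-refl; _<?_; ≮⇒≥)
open import Data.Fin using (Fin; zero)
open import Data.Fin.Subset using (Subset; _∈_)
open import Data.Fin.Subset.Properties using (_∈?_)
open import Data.Product using (∃-syntax; _×_; _,_; proj₁)
open import Data.Sum using (_⊎_; inj₁; inj₂)
open import Relation.Nullary using (yes; no)
open import Relation.Binary.PropositionalEquality using (refl)

module _ {n : ℕ} (G : Graph n) where

  WalkIn⇒Walk : ∀ {P : Fin n → Set} {a b k} → WalkIn G P a b k → Walk G a b k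
  WalkIn⇒Walk {a = a} (here _)     = here a
  WalkIn⇒Walk {a = a} (step e _ w) = step e a (WalkIn⇒Walk w)

  DiamInducedLe : ℕ → Subset n → Set
  DiamInducedLe K X = ∀ a b → a ∈ X → b ∈ X → ∃[ k ] (k ≤ K × DistIn G X a b k)

  ShortWalksShortcutIn : ℕ → Subset n → Set
  ShortWalksShortcutIn K X = ∀ {a b m} → a ∈ X → b ∈ X → m < K → Walk G a b m →
    ∃[ m′ ] (m′ ≤ m × WalkInSet G X a b m′)

  diamInducedLe⇒weaklyConvex : ∀ {K X} → DiamInducedLe K X →
    ShortWalksShortcutIn K X → WeaklyConvex G X
  diamInducedLe⇒weaklyConvex {K} diam shortcut a b aX bX
    with diam a b aX bX
  ... | k , k≤K , w , minimal = k , (WalkIn⇒Walk w , shortest) , w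
    where
      shortest : ∀ m → Walk G a b m → k ≤ m
      shortest m v with m <? K
      ... | no m≮K = ≤-trans k≤K (≮⇒≥ m≮K)
      ... | yes m<K with shortcut aX bX m<K v
      ...   | m′ , m′≤m , v′ = ≤-trans (minimal m′ v′) m′≤m

  shortWalksShortcutIn-2 : ∀ {X} → ShortWalksShortcutIn 2 X
  shortWalksShortcutIn-2 aX bX (s≤s z≤n) (here _) =
    0 , ≤-refl , here aX
  shortWalksShortcutIn-2 aX bX (s≤s (s≤s z≤n)) (step e _ (here _)) =
    1 , ≤-refl , step e aX (here bX)

  perfect⇒shortWalksShortcutIn-3 : ∀ {D} → PerfectCDS G D → ShortWalksShortcutIn 3 D
  perfect⇒shortWalksShortcutIn-3 _ aD bD (s≤s z≤n) =
    shortWalksShortcutIn-2 aD bD (s≤s z≤n)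
  perfect⇒shortWalksShortcutIn-3 _ aD bD (s≤s (s≤s z≤n)) =
    shortWalksShortcutIn-2 aD bD (s≤s (s≤s z≤n))
  perfect⇒shortWalksShortcutIn-3 {D} (_ , unique) aD bD (s≤s (s≤s (s≤s z≤n)))
    (step {b = x} ax _ (step xb _ (here _))) with x ∈? D
  ... | yes xD = 2 , ≤-refl , step ax aD (step xb xD (here bD))
  ... | no x∉D with unique x _ _ x∉D aD bD (sym G ax) xb
  ...   | refl = 0 , z≤n , here aD

weaklyConvexDominating⇒connectedDominating : ∀ {n} (G : Graph (suc n)) X →
  WeaklyConvexDominating G X → ConnectedDominating G X
weaklyConvexDominating⇒connectedDominating G X (convex , dom) =
  dom , nonempty , λ a b aX bX → let (k , _ , w) = convex a b aX bX in k , w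
  where
    nonempty : ∃[ v ] v ∈ X
    nonempty with zero ∈? X
    ... | yes 0∈X = zero , 0∈X
    ... | no 0∉X  = let (u , u∈X , _) = dom zero 0∉X in u , u∈X

lemma2p4 : {n : ℕ} (G : Graph (suc n)) → Connected G →
    (∃[ D ] (MinConnectedDominating G D ×
              (DiamInducedLe2 G D ⊎ (PerfectCDS G D × DiamInducedEq3 G D)))) →
    ∃[ k ] (IsGammaC G k × IsGammaWcon G k)
lemma2p4 G _ (D , (cds , minimum) , shape) =
  _ , ((D , cds , refl) , minimum) ,
      ((D , (convex shape , proj₁ cds) , refl) ,
       λ X wcds → minimum X (weaklyConvexDominating⇒connectedDominating G X wcds))
  where
    convex : DiamInducedLe2 G D ⊎ (PerfectCDS G D × DiamInducedEq3 G D) →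
             WeaklyConvex G D
    convex (inj₁ diam) =
      diamInducedLe⇒weaklyConvex G diam (shortWalksShortcutIn-2 G)
    convex (inj₂ (perfect , diam , _)) =
      diamInducedLe⇒weaklyConvex G diam (perfect⇒shortWalksShortcutIn-3 G perfect)
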